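{- Let $i\ge0$ be an integer, $G$ an $\alpha_i$-metric graph, and $x,y$ a pair of mutually distant vertices of $G$. Then $d(x,y)\ge 2\operatorname{rad}(G)-4i-3$ and $d(x,y)\ge\operatorname{diam}(G)-3i-2$. Furthermore, any middle vertex $z$ of a shortest path between $x$ and $y$ satisfies $e(z)\le\lceil d(x,y)/2\rceil+2i+1$.
   Context: All graphs are finite, connected, unweighted, undirected, simple; $d(u,v)$ is the shortest-path distance. $I(u,v)=\{x: d(u,x)+d(x,v)=d(u,v)\}$. A graph is $\alpha_i$-metric if for all vertices $u,w,v,x$: whenever $v\in I(u,w)$, $w\in I(v,x)$ and $vw$ is an edge, then $d(u,x)\ge d(u,v)+d(v,x)-i$. $e(v)=\max_u d(u,v)$; $\operatorname{rad}(G)=\min_v e(v)$; $\operatorname{diam}(G)=\max_v e(v)$. Vertices $x,y$ are mutually distant if $e(x)=e(y)=d(x,y)$. A middle vertex of a shortest $(x,y)$-path is a vertex $z$ of that path with $\{d(x,z),d(z,y)\}=\{\lfloor d(x,y)/2\rfloor,\lceil d(x,y)/2\rceil\}$. -}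

module Defs where

open import Data.Nat using (ℕ; zero; suc; _+_; _≤_; _⊔_; _⊓_)
open import Data.Fin using (Fin; fromℕ; inject₁)
open import Data.Product using (_×_; Σ)
open import Data.Empty using (⊥)
open import Relation.Nullary using (¬_)
open import Relation.Binary.PropositionalEquality using (_≡_)
open import Level using (0ℓ)

record Graph (n : ℕ) : Set₁ where
  field
    Adj    : Fin n → Fin n → Set
    sym    : ∀ {u v} → Adj u v → Adj v u
    irrefl : ∀ {u} → ¬ Adj u u
open Graph public

data Walk {n : ℕ} (G : Graph n) : Fin n → Fin n → ℕ → Set where
  here : ∀ {u} → Walk G u u 0
  step : ∀ {u w v k} → Adj G u w → Walk G w v k → Walk G u v (suc k)

-- d is the shortest-path distance of G: d u v is the length of some walk
-- from u to v, and no walk from u to v is shorter.  (This determines d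
-- uniquely, and its existence forces G to be connected.)
IsDistance : ∀ {n} → Graph n → (Fin n → Fin n → ℕ) → Set
IsDistance G d = ∀ u v → Walk G u v (d u v) × (∀ k → Walk G u v k → d u v ≤ k)

record ShortestPath {n : ℕ} (G : Graph n) (d : Fin n → Fin n → ℕ) (x y : Fin n) : Set where
  field
    vertex : Fin (suc (d x y)) → Fin n
    start  : vertex Fin.zero ≡ x
    end    : vertex (fromℕ (d x y)) ≡ y
    edges  : ∀ (j : Fin (d x y)) → Adj G (vertex (inject₁ j)) (vertex (Fin.suc j))
open ShortestPath public

_∈I[_,_]_ : ∀ {n} → Fin n → Fin n → Fin n → (Fin n → Fin n → ℕ) → Set
x ∈I[ u , v ] d = d u x + d x v ≡ d u v

-- α_i-metric, with the subtraction moved to the other side.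
IsAlphaMetric : ∀ {n} → Graph n → (Fin n → Fin n → ℕ) → ℕ → Set
IsAlphaMetric G d i = ∀ u w v x → v ∈I[ u , w ] d → w ∈I[ v , x ] d → Adj G v w →
  d u v + d v x ≤ d u x + i

maxF : ∀ {n} → (Fin n → ℕ) → ℕ
maxF {zero} f = 0
maxF {suc n} f = f Fin.zero ⊔ maxF (λ j → f (Fin.suc j))

minF : ∀ {n} → (Fin (suc n) → ℕ) → ℕ
minF {zero} f = f Fin.zero
minF {suc n} f = f Fin.zero ⊓ minF (λ j → f (Fin.suc j))

ecc : ∀ {n} → (Fin n → Fin n → ℕ) → Fin n → ℕ
ecc d v = maxF (λ u → d u v)

rad : ∀ {n} → (Fin (suc n) → Fin (suc n) → ℕ) → ℕ
rad d = minF (ecc d)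

diam : ∀ {n} → (Fin (suc n) → Fin (suc n) → ℕ) → ℕ
diam d = maxF (ecc d)

MutuallyDistant : ∀ {n} → (Fin n → Fin n → ℕ) → Fin n → Fin n → Set
MutuallyDistant d x y = ecc d x ≡ d x y × ecc d y ≡ d x y

-- Let D = d(x,y) and call the vertices u with d(x,u) = p and d(u,y) = q, where
-- p + q = D, a slice of I(x,y).  Since x and y are mutually distant, every
-- vertex lies within D of both, and the α_i-condition then says: stepping from
-- a slice vertex u towards a vertex w with d(u,w) > max(p,q) + i keeps us in
-- the slice.  Hence every vertex is within max(p,q) + i of the slice, and the
-- slice vertices have eccentricity at most max(p,q) + 2i + 1: from a slice
-- vertex z with a vertex w even farther away, walk i + 1 steps towards w
-- (staying in the slice) and then one step towards x; the α_i-condition forces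
-- the new vertex to be on a shortest (z,w)-path again, hence in the slice,
-- although it is closer to x.  Taking p and q to be the halves of D gives all
-- three bounds.
module Submission where

open import Defs renaming (sym to adj-sym)
open import Data.Nat using (ℕ; zero; suc; _+_; _*_; _≤_; _<_; _∸_; z≤n; s≤s; s≤s⁻¹; z<s; _≤?_; ⌊_/2⌋; ⌈_/2⌉)
open import Data.Nat.Properties
open import Data.Nat.Tactic.RingSolver using (solve)
open import Data.List using (_∷_; [])
open import Data.Fin using (Fin)
open import Data.Product using (_×_; ∃; _,_; proj₁; proj₂)
open import Data.Sum using (_⊎_; [_,_]′)
open import Data.Empty using (⊥)
open import Relation.Nullary using (¬_; yes; no; contradiction)
open import Relation.Binary.PropositionalEquality

maxF-upper : ∀ {n} (f : Fin n → ℕ) j → f j ≤ maxF f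
maxF-upper {suc n} f Fin.zero    = m≤m⊔n _ _
maxF-upper {suc n} f (Fin.suc j) = ≤-trans (maxF-upper (λ k → f (Fin.suc k)) j) (m≤n⊔m _ _)

maxF-lub : ∀ {n} (f : Fin n → ℕ) {B} → (∀ j → f j ≤ B) → maxF f ≤ B
maxF-lub {zero}  f h = z≤n
maxF-lub {suc n} f h = ⊔-lub (h Fin.zero) (maxF-lub (λ k → f (Fin.suc k)) (λ k → h (Fin.suc k)))

minF-lower : ∀ {n} (f : Fin (suc n) → ℕ) j → minF f ≤ f j
minF-lower {zero}  f Fin.zero    = ≤-refl
minF-lower {suc n} f Fin.zero    = m⊓n≤m _ _
minF-lower {suc n} f (Fin.suc j) = ≤-trans (m⊓n≤n _ _) (minF-lower (λ k → f (Fin.suc k)) j)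

+-≤-squeeze : ∀ {a b p q} → a ≤ p → b ≤ q → p + q ≤ a + b → a ≡ p × b ≡ q
+-≤-squeeze {a} {b} {p} {q} a≤p b≤q p+q≤a+b =
  ≤-antisym a≤p (+-cancelʳ-≤ q p a (≤-trans p+q≤a+b (+-monoʳ-≤ a b≤q))) ,
  ≤-antisym b≤q (+-cancelˡ-≤ p q b (≤-trans p+q≤a+b (+-monoˡ-≤ b a≤p)))

⌈n/2⌉+⌈n/2⌉≤1+n : ∀ n → ⌈ n /2⌉ + ⌈ n /2⌉ ≤ suc n
⌈n/2⌉+⌈n/2⌉≤1+n zero          = z≤n
⌈n/2⌉+⌈n/2⌉≤1+n (suc zero)    = ≤-refl
⌈n/2⌉+⌈n/2⌉≤1+n (suc (suc n)) =
  s≤s (subst (_≤ suc (suc n)) (sym (+-suc ⌈ n /2⌉ ⌈ n /2⌉)) (s≤s (⌈n/2⌉+⌈n/2⌉≤1+n n)))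

2*[q+2i+1]≤n+4i+3 : ∀ {n q} i → q + q ≤ suc n → 2 * (q + 2 * i + 1) ≤ n + 4 * i + 3
2*[q+2i+1]≤n+4i+3 {n} {q} i q+q≤1+n = begin
  2 * (q + 2 * i + 1)   ≡⟨ solve (q ∷ i ∷ []) ⟩
  (q + q) + (4 * i + 2) ≤⟨ +-monoˡ-≤ (4 * i + 2) q+q≤1+n ⟩
  suc n + (4 * i + 2)   ≡⟨ solve (n ∷ i ∷ []) ⟩
  n + 4 * i + 3         ∎
  where open ≤-Reasoning

[q+i]+[q+2i+1]≤n+3i+2 : ∀ {n q} i → q + q ≤ suc n → (q + i) + (q + 2 * i + 1) ≤ n + 3 * i + 2
[q+i]+[q+2i+1]≤n+3i+2 {n} {q} i q+q≤1+n = begin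
  (q + i) + (q + 2 * i + 1) ≡⟨ solve (q ∷ i ∷ []) ⟩
  (q + q) + (3 * i + 1)     ≤⟨ +-monoˡ-≤ (3 * i + 1) q+q≤1+n ⟩
  suc n + (3 * i + 1)       ≡⟨ solve (n ∷ i ∷ []) ⟩
  n + 3 * i + 2             ∎
  where open ≤-Reasoning

m+2i+1<n⇒m+i+[1+i]≤n : ∀ {m n} i → m + 2 * i + 1 < n → m + i + suc i ≤ n
m+2i+1<n⇒m+i+[1+i]≤n {m} {n} i m+2i+1<n = begin
  m + i + suc i ≡⟨ solve (m ∷ i ∷ []) ⟩
  m + 2 * i + 1 ≤⟨ <⇒≤ m+2i+1<n ⟩
  n             ∎
  where open ≤-Reasoning

+-shift-< : ∀ {a b n k} j → a + b ≡ n → b + j < k → n + j < a + k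
+-shift-< {a} {b} {n} {k} j a+b≡n b+j<k = begin-strict
  n + j       ≡⟨ cong (_+ j) a+b≡n ⟨
  a + b + j   ≡⟨ +-assoc a b j ⟩
  a + (b + j) <⟨ +-monoʳ-< a b+j<k ⟩
  a + k       ∎
  where open ≤-Reasoning

module _ {N : ℕ} {G : Graph N} where

  _++ʷ_ : ∀ {u v w a b} → Walk G u v a → Walk G v w b → Walk G u w (a + b)
  here     ++ʷ q = q
  step e p ++ʷ q = step e (p ++ʷ q)

  snocʷ : ∀ {u v w a} → Walk G u v a → Adj G v w → Walk G u w (suc a)
  snocʷ here       e = step e here
  snocʷ (step f p) e = step f (snocʷ p e)

  reverseʷ : ∀ {u v a} → Walk G u v a → Walk G v u a
  reverseʷ here       = here
  reverseʷ (step e p) = snocʷ (reverseʷ p) (adj-sym G e)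

  splitAtʷ : ∀ {u w} a {b} → Walk G u w (a + b) → ∃ λ v → Walk G u v a × Walk G v w b
  splitAtʷ zero    p          = _ , here , p
  splitAtʷ (suc a) (step e p) with splitAtʷ a p
  ... | v , p₁ , p₂ = v , step e p₁ , p₂

  walk-length-0 : ∀ {u v} → Walk G u v 0 → u ≡ v
  walk-length-0 here = refl

  walk-length-1 : ∀ {u v} → Walk G u v 1 → Adj G u v
  walk-length-1 (step e here) = e

module Distance {N : ℕ} (G : Graph N) (d : Fin N → Fin N → ℕ) (isD : IsDistance G d) where

  geodesic : ∀ u v → Walk G u v (d u v)
  geodesic u v = proj₁ (isD u v)

  d≤length : ∀ {u v k} → Walk G u v k → d u v ≤ k
  d≤length {u} {v} {k} = proj₂ (isD u v) k

  d-sym : ∀ u v → d u v ≡ d v u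
  d-sym u v = ≤-antisym (d≤length (reverseʷ (geodesic v u))) (d≤length (reverseʷ (geodesic u v)))

  triangle : ∀ u v w → d u w ≤ d u v + d v w
  triangle u v w = d≤length (geodesic u v ++ʷ geodesic v w)

  d≡0⇒≡ : ∀ {u v} → d u v ≡ 0 → u ≡ v
  d≡0⇒≡ {u} {v} uv≡0 = walk-length-0 (subst (Walk G u v) uv≡0 (geodesic u v))

  adj⇒d≡1 : ∀ {u v} → Adj G u v → d u v ≡ 1
  adj⇒d≡1 {u} {v} e with d u v ≟ 0
  ... | yes uv≡0 = contradiction (subst (Adj G u) (sym (d≡0⇒≡ uv≡0)) e) (irrefl G)
  ... | no  uv≢0 = ≤-antisym (d≤length (step e here)) (n≢0⇒n>0 uv≢0)

  adj-triangle : ∀ a {u t} → Adj G u t → d a t ≤ d a u + 1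
  adj-triangle a {u} {t} e = subst (λ k → d a t ≤ d a u + k) (adj⇒d≡1 e) (triangle a u t)

  ≤-ecc : ∀ u v → d u v ≤ ecc d v
  ≤-ecc u v = maxF-upper (λ w → d w v) u

  ecc-lub : ∀ {v B} → (∀ w → d v w ≤ B) → ecc d v ≤ B
  ecc-lub {v} h = maxF-lub (λ w → d w v) (λ w → subst (_≤ _) (d-sym v w) (h w))

  geodesic-split : ∀ {u w} a b → d u w ≡ a + b → ∃ λ v → d u v ≡ a × d v w ≡ b
  geodesic-split {u} {w} a b uw≡a+b with splitAtʷ a (subst (Walk G u w) uw≡a+b (geodesic u w))
  ... | v , p₁ , p₂ =
    v , +-≤-squeeze (d≤length p₁) (d≤length p₂) (subst (_≤ d u v + d v w) uw≡a+b (triangle u v w))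

  geodesic-prefix : ∀ {u w a} → a ≤ d u w → ∃ λ v → d u v ≡ a × d u v + d v w ≡ d u w
  geodesic-prefix {u} {w} {a} a≤uw with geodesic-split a (d u w ∸ a) (sym (m+[n∸m]≡n a≤uw))
  ... | v , uv≡a , vw≡uw∸a = v , uv≡a , trans (cong₂ _+_ uv≡a vw≡uw∸a) (m+[n∸m]≡n a≤uw)

  geodesic-step : ∀ {u w k} → d u w ≡ suc k → ∃ λ t → Adj G u t × d t w ≡ k
  geodesic-step {u} {w} {k} uw≡1+k with geodesic-split 1 k uw≡1+k
  ... | t , ut≡1 , tw≡k = t , walk-length-1 (subst (Walk G u t) ut≡1 (geodesic u t)) , tw≡k

  geodesic-suffix : ∀ {u t v w} → d u t + d t v ≡ d u v → d u v + d v w ≡ d u w →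
                    d t v + d v w ≡ d t w
  geodesic-suffix {u} {t} {v} {w} utv uvw = sym (proj₂ (+-≤-squeeze ≤-refl (triangle t v w) uw≤))
    where
    uw≤ : d u t + (d t v + d v w) ≤ d u t + d t w
    uw≤ = subst (_≤ d u t + d t w)
            (trans (sym uvw) (trans (cong (_+ d v w) (sym utv)) (+-assoc (d u t) (d t v) (d v w))))
            (triangle u t w)

module AlphaMetric {N : ℕ} (G : Graph N) (d : Fin N → Fin N → ℕ) (isD : IsDistance G d)
                   (i : ℕ) (α : IsAlphaMetric G d i) where
  open Distance G d isD

  step-toward-keeps-distance : ∀ {a u t w B} → d a w ≤ B → Adj G u t → d u w ≡ suc (d t w) →
                               B + i < d a u + d u w → d a t ≤ d a u
  step-toward-keeps-distance {a} {u} {t} {w} aw≤B e uw≡1+tw B+i<au+uw = ≮⇒≥ λ au<at →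
    <⇒≱ B+i<au+uw (≤-trans (α a t u w (u∈I[a,t] au<at) t∈I[u,w] e) (+-monoˡ-≤ i aw≤B))
    where
    u∈I[a,t] : d a u < d a t → d a u + d u t ≡ d a t
    u∈I[a,t] au<at = trans (cong (d a u +_) (adj⇒d≡1 e))
      (≤-antisym (subst (_≤ d a t) (+-comm 1 (d a u)) au<at) (adj-triangle a e))
    t∈I[u,w] : d u t + d t w ≡ d u w
    t∈I[u,w] = trans (cong (_+ d t w) (adj⇒d≡1 e)) (sym uw≡1+tw)

  module FarPair (x y : Fin N) (x-far : ∀ w → d x w ≤ d x y) (y-far : ∀ w → d y w ≤ d x y) where

    Slice : ℕ → ℕ → Fin N → Set
    Slice p q u = d x u ≡ p × d u y ≡ q

    module SliceBounds {p q M : ℕ} (p+q≡D : p + q ≡ d x y) (p≤M : p ≤ M) (q≤M : q ≤ M) where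

      slice-step : ∀ {u t w} → Slice p q u → Adj G u t → d u w ≡ suc (d t w) → M + i < d u w →
                   Slice p q t
      slice-step {u} {t} {w} (xu≡p , uy≡q) e uw≡1+tw M+i<uw =
        +-≤-squeeze xt≤p ty≤q (subst (_≤ d x t + d t y) (sym p+q≡D) (triangle x t y))
        where
        yu≡q : d y u ≡ q
        yu≡q = trans (d-sym y u) uy≡q
        xt≤p : d x t ≤ p
        xt≤p = subst (d x t ≤_) xu≡p (step-toward-keeps-distance (x-far w) e uw≡1+tw
          (subst (λ a → d x y + i < a + d u w) (sym xu≡p)
            (+-shift-< i p+q≡D (≤-<-trans (+-monoˡ-≤ i q≤M) M+i<uw))))
        ty≤q : d t y ≤ q
        ty≤q = subst₂ _≤_ (d-sym y t) yu≡q (step-toward-keeps-distance (y-far w) e uw≡1+tw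
          (subst (λ a → d x y + i < a + d u w) (sym yu≡q)
            (+-shift-< i (trans (+-comm q p) p+q≡D) (≤-<-trans (+-monoˡ-≤ i p≤M) M+i<uw))))

      slice-geodesic : ∀ n {u v w} → Slice p q u → d u v ≡ n → d u v + d v w ≡ d u w →
                       M + i + n ≤ d u w → Slice p q v
      slice-geodesic zero    s uv≡0 _ _ = subst (Slice p q) (d≡0⇒≡ uv≡0) s
      slice-geodesic (suc n) {u} {v} {w} s uv≡1+n uvw M+i+1+n≤uw with geodesic-step uv≡1+n
      ... | t , e , tv≡n =
        slice-geodesic n (slice-step s e uw≡1+tw (<-≤-trans (m<m+n (M + i) z<s) M+i+1+n≤uw)) tv≡n tvw
          (s≤s⁻¹ (subst₂ _≤_ (+-suc (M + i) n) uw≡1+tw M+i+1+n≤uw))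
        where
        tvw : d t v + d v w ≡ d t w
        tvw = geodesic-suffix (trans (cong₂ _+_ (adj⇒d≡1 e) tv≡n) (sym uv≡1+n)) uvw
        uw≡1+tw : d u w ≡ suc (d t w)
        uw≡1+tw = trans (sym uvw) (trans (cong (_+ d v w) (trans uv≡1+n (cong suc (sym tv≡n)))) (cong suc tvw))

      slice-near : ∀ {c} → Slice p q c → ∀ a → ∃ λ c′ → Slice p q c′ × d c′ a ≤ M + i
      slice-near s a = go _ s refl
        where
        go : ∀ k {c} → Slice p q c → d c a ≡ k → ∃ λ c′ → Slice p q c′ × d c′ a ≤ M + i
        go zero    {c} s ca≡0 = c , s , subst (_≤ M + i) (sym ca≡0) z≤n
        go (suc k) {c} s ca≡1+k with suc k ≤? M + i | geodesic-step ca≡1+k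
        ... | yes 1+k≤M+i | _ = c , s , subst (_≤ M + i) (sym ca≡1+k) 1+k≤M+i
        ... | no  1+k≰M+i | t , e , ta≡k =
          go k (slice-step s e (trans ca≡1+k (cong suc (sym ta≡k)))
                  (subst (M + i <_) (sym ca≡1+k) (≰⇒> 1+k≰M+i))) ta≡k

      step-toward-x-stays-on-geodesic :
        ∀ {z g m w} → Slice p q z → Slice p q g → d z g ≡ suc i → d z g + d g w ≡ d z w →
        q + i < d g w → Adj G g m → d g x ≡ suc (d m x) →
        d z m ≡ suc i × d z m + d m w ≡ d z w
      step-toward-x-stays-on-geodesic {z} {g} {m} {w} (xz≡p , _) (xg≡p , _) zg≡1+i zgw q+i<gw e gx≡1+mx =
        trans zm≡zg zg≡1+i , trans (cong₂ _+_ zm≡zg mw≡gw) zgw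
        where
        zx≡gx : d z x ≡ d g x
        zx≡gx = trans (d-sym z x) (trans xz≡p (sym (trans (d-sym g x) xg≡p)))
        zm≤zg : d z m ≤ d z g
        zm≤zg = step-toward-keeps-distance ≤-refl e gx≡1+mx (subst₂ (λ a b → a + i < b + d g x)
          (sym zx≡gx) (sym zg≡1+i) (s≤s (≤-reflexive (+-comm (d g x) i))))
        wm≤wg : d w m ≤ d w g
        wm≤wg = step-toward-keeps-distance (subst (_≤ d x y) (d-sym x w) (x-far w)) e gx≡1+mx
          (subst₂ (λ a b → d x y + i < a + b) (d-sym g w) (trans (sym xg≡p) (d-sym x g))
            (subst (d x y + i <_) (+-comm p (d g w)) (+-shift-< i p+q≡D q+i<gw)))
        zm≡zg×mw≡gw : d z m ≡ d z g × d m w ≡ d g w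
        zm≡zg×mw≡gw = +-≤-squeeze zm≤zg (subst₂ _≤_ (d-sym w m) (d-sym w g) wm≤wg)
          (subst (_≤ d z m + d m w) (sym zgw) (triangle z m w))
        zm≡zg : d z m ≡ d z g
        zm≡zg = proj₁ zm≡zg×mw≡gw
        mw≡gw : d m w ≡ d g w
        mw≡gw = proj₂ zm≡zg×mw≡gw

      far-from-slice-absurd :
        ∀ {z g w k} → Slice p q z → Slice p q g → d z g ≡ suc i → d z g + d g w ≡ d z w →
        d g x ≡ suc k → M + 2 * i + 1 < d z w → ⊥
      far-from-slice-absurd {z} {g} {w} {k} s sg zg≡1+i zgw gx≡1+k far
        with d g w ≤? q + i | geodesic-step gx≡1+k
      ... | yes gw≤q+i | _ = <⇒≱ far (begin
        d z w           ≡⟨ sym zgw ⟩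
        d z g + d g w   ≤⟨ +-mono-≤ (≤-reflexive zg≡1+i) gw≤q+i ⟩
        suc i + (q + i) ≡⟨ solve (q ∷ i ∷ []) ⟩
        q + 2 * i + 1   ≤⟨ +-monoˡ-≤ 1 (+-monoˡ-≤ (2 * i) q≤M) ⟩
        M + 2 * i + 1   ∎)
        where open ≤-Reasoning
      ... | no gw≰q+i | m , e , mx≡k = 1+n≢n (begin
        suc k ≡⟨ sym gx≡1+k ⟩
        d g x ≡⟨ d-sym g x ⟩
        d x g ≡⟨ proj₁ sg ⟩
        p     ≡⟨ sym (proj₁ sm) ⟩
        d x m ≡⟨ d-sym x m ⟩
        d m x ≡⟨ mx≡k ⟩
        k     ∎)
        where
        open ≡-Reasoning
        m-on-geodesic : d z m ≡ suc i × d z m + d m w ≡ d z w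
        m-on-geodesic = step-toward-x-stays-on-geodesic s sg zg≡1+i zgw (≰⇒> gw≰q+i) e
          (trans gx≡1+k (cong suc (sym mx≡k)))
        sm : Slice p q m
        sm = slice-geodesic (suc i) s (proj₁ m-on-geodesic) (proj₂ m-on-geodesic)
          (m+2i+1<n⇒m+i+[1+i]≤n i far)

      slice-ecc : ∀ {z} → Slice p q z → ∀ w → d z w ≤ M + 2 * i + 1
      slice-ecc {z} s w = ≮⇒≥ far-case
        where
        far-case : ¬ (M + 2 * i + 1 < d z w)
        far-case far with d z x in zx≡ | geodesic-prefix 1+i≤zw
          where
          1+i≤zw : suc i ≤ d z w
          1+i≤zw = ≤-trans (m≤n+m (suc i) (M + i)) (m+2i+1<n⇒m+i+[1+i]≤n i far)
        ... | zero  | _ = <⇒≱ far (begin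
          d z w   ≡⟨ cong (λ v → d v w) (d≡0⇒≡ zx≡) ⟩
          d x w   ≤⟨ x-far w ⟩
          d x y   ≡⟨ sym p+q≡D ⟩
          p + q   ≡⟨ cong (_+ q) (trans (sym (proj₁ s)) (trans (d-sym x z) zx≡)) ⟩
          q       ≤⟨ q≤M ⟩
          M       ≤⟨ m≤m+n M (2 * i + 1) ⟩
          M + (2 * i + 1) ≡⟨ sym (+-assoc M (2 * i) 1) ⟩
          M + 2 * i + 1 ∎)
          where open ≤-Reasoning
        ... | suc k | g , zg≡1+i , zgw =
          far-from-slice-absurd s sg zg≡1+i zgw gx≡1+k far
          where
          sg : Slice p q g
          sg = slice-geodesic (suc i) s zg≡1+i zgw (m+2i+1<n⇒m+i+[1+i]≤n i far)
          gx≡1+k : d g x ≡ suc k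
          gx≡1+k = begin
            d g x ≡⟨ d-sym g x ⟩
            d x g ≡⟨ proj₁ sg ⟩
            p     ≡⟨ proj₁ s ⟨
            d x z ≡⟨ d-sym x z ⟩
            d z x ≡⟨ zx≡ ⟩
            suc k ∎
            where open ≡-Reasoning

lemma6 : (i n : ℕ) (G : Graph (suc n)) (d : Fin (suc n) → Fin (suc n) → ℕ) →
    IsDistance G d → IsAlphaMetric G d i →
    (x y : Fin (suc n)) → MutuallyDistant d x y →
    (2 * rad d ≤ d x y + 4 * i + 3)
    × (diam d ≤ d x y + 3 * i + 2)
    × ((P : ShortestPath G d x y) (j : Fin (suc (d x y))) →
        ((d x (vertex P j) ≡ ⌊ d x y /2⌋ × d (vertex P j) y ≡ ⌈ d x y /2⌉)
          ⊎ (d x (vertex P j) ≡ ⌈ d x y /2⌉ × d (vertex P j) y ≡ ⌊ d x y /2⌋)) →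
        ecc d (vertex P j) ≤ ⌈ d x y /2⌉ + 2 * i + 1)
lemma6 i n G d isD α x y (ecc-x≡D , ecc-y≡D) =
  rad-bound , diam-bound ,
  λ _ _ → [ (λ s → ecc-lub (slice-ecc s)) , (λ s → ecc-lub (Swapped.slice-ecc s)) ]′
  where
  open Distance G d isD
  open AlphaMetric G d isD i α
  D : ℕ
  D = d x y
  far-from : ∀ v → ecc d v ≡ D → ∀ w → d v w ≤ D
  far-from v ecc-v≡D w = subst₂ _≤_ (d-sym w v) ecc-v≡D (≤-ecc w v)
  open FarPair x y (far-from x ecc-x≡D) (far-from y ecc-y≡D)
  open SliceBounds {M = ⌈ D /2⌉} (⌊n/2⌋+⌈n/2⌉≡n D) (⌊n/2⌋≤⌈n/2⌉ D) ≤-refl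
  module Swapped = SliceBounds {M = ⌈ D /2⌉}
    (trans (+-comm ⌈ D /2⌉ ⌊ D /2⌋) (⌊n/2⌋+⌈n/2⌉≡n D)) ≤-refl (⌊n/2⌋≤⌈n/2⌉ D)

  middle : ∃ λ z → Slice ⌊ D /2⌋ ⌈ D /2⌉ z
  middle = geodesic-split ⌊ D /2⌋ ⌈ D /2⌉ (sym (⌊n/2⌋+⌈n/2⌉≡n D))

  rad-bound : 2 * rad d ≤ D + 4 * i + 3
  rad-bound = ≤-trans
    (*-monoʳ-≤ 2 (≤-trans (minF-lower (ecc d) (proj₁ middle)) (ecc-lub (slice-ecc (proj₂ middle)))))
    (2*[q+2i+1]≤n+4i+3 {q = ⌈ D /2⌉} i (⌈n/2⌉+⌈n/2⌉≤1+n D))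

  diam-bound : diam d ≤ D + 3 * i + 2
  diam-bound = maxF-lub (ecc d) λ b → maxF-lub (λ a → d a b) λ a → dist-bound a b
    where
    dist-bound : ∀ a b → d a b ≤ D + 3 * i + 2
    dist-bound a b with slice-near (proj₂ middle) a
    ... | c , sc , ca≤ = begin
      d a b                                 ≤⟨ triangle a c b ⟩
      d a c + d c b                         ≤⟨ +-mono-≤ (subst (_≤ ⌈ D /2⌉ + i) (d-sym c a) ca≤)
                                                        (slice-ecc sc b) ⟩
      (⌈ D /2⌉ + i) + (⌈ D /2⌉ + 2 * i + 1) ≤⟨ [q+i]+[q+2i+1]≤n+3i+2 {q = ⌈ D /2⌉} i (⌈n/2⌉+⌈n/2⌉≤1+n D) ⟩
      D + 3 * i + 2                         ∎
      where open ≤-Reasoning
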